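{- Let $G$ be a finite abelian group, written additively, let $A=\{a_1,\dots,a_m\}\subseteq G$, and let $t$ be a nonnegative integer. Then $A$ is $t$-independent in $G$ if, and only if, all of the following hold: (i) $A$ is zero-$h$-sum-free for every $h$ with $1\le h\le t$; (ii) $A$ is $(k,\ell)$-sum-free for all integers $k,\ell$ with $1\le \ell<k\le t-\ell$; (iii) $A$ is a $B_h$ set for every $h$ with $2\le h\le \lfloor t/2\rfloor$.
   Context: $A=\{a_1,\dots,a_m\}\subseteq G$ is called $t$-independent in $G$ if the only way to have $\lambda_1 a_1+\lambda_2 a_2+\cdots+\lambda_m a_m=0$ with $\lambda_1,\dots,\lambda_m\in\mathbb{Z}$ and $\sum_{i=1}^m|\lambda_i|\le t$ is $\lambda_1=\cdots=\lambda_m=0$. For $h\in\mathbb{N}$, $A$ is zero-$h$-sum-free if the equation $x_1+x_2+\cdots+x_h=0$ has no solutions with $x_1,\dots,x_h\in A$ (not necessarily distinct). For $k,\ell\in\mathbb{N}$ with $k\ne\ell$, $A$ is $(k,\ell)$-sum-free if $x_1+\cdots+x_k=y_1+\cdots+y_\ell$ has no solutions with all $x_i,y_j\in A$ (not necessarily distinct). For $h\in\mathbb{N}$, $A$ is a $B_h$ set if $x_1+\cdots+x_h=y_1+\cdots+y_h$ with all $x_i,y_j\in A$ has only trivial solutions, i.e. those where $(y_1,\dots,y_h)$ is a rearrangement of $(x_1,\dots,x_h)$. -}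

module Defs where

open import Level using (Level; _⊔_)
open import Algebra.Bundles using (AbelianGroup)
open import Data.Nat using (ℕ; zero; suc; _+_; _≤_; _<_)
open import Data.Integer using (ℤ; +_; -[1+_]; ∣_∣)
open import Data.Fin using (Fin)
open import Data.Fin.Permutation using (Permutation′; _⟨$⟩ʳ_)
open import Data.Product using (Σ; ∃; _×_; _,_)
open import Relation.Binary.PropositionalEquality using (_≡_)
open import Relation.Nullary using (¬_)
import Algebra.Definitions.RawMonoid as RM

finSumℕ : ∀ {n} → (Fin n → ℕ) → ℕ
finSumℕ {zero}  f = 0
finSumℕ {suc n} f = f Fin.zero + finSumℕ (λ i → f (Fin.suc i))
  where import Data.Fin as Fin

module _ {c ℓ : Level} (G : AbelianGroup c ℓ) where
  open AbelianGroup G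
  open RM rawMonoid using (sum) renaming (_×_ to _·ℕ_)

  _·ℤ_ : ℤ → Carrier → Carrier
  (+ n)    ·ℤ x = n ·ℕ x
  -[1+ n ] ·ℤ x = (suc n ·ℕ x) ⁻¹

  IsFiniteGroup : Set (c ⊔ ℓ)
  IsFiniteGroup = Σ ℕ λ n → Σ (Fin n → Carrier) λ f → ∀ x → ∃ λ i → f i ≈ x

  -- a : Fin m → G enumerates A = {a_1,…,a_m} with distinct elements
  Distinct : ∀ {m} → (Fin m → Carrier) → Set ℓ
  Distinct a = ∀ i j → a i ≈ a j → i ≡ j

  Independent : ∀ {m} → ℕ → (Fin m → Carrier) → Set ℓ
  Independent t a = (λs : Fin _ → ℤ) → finSumℕ (λ i → ∣ λs i ∣) ≤ t →
    sum (λ i → λs i ·ℤ a i) ≈ ε → ∀ i → λs i ≡ + 0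

  ZeroSumFree : ∀ {m} → ℕ → (Fin m → Carrier) → Set ℓ
  ZeroSumFree h a = (x : Fin h → Fin _) → ¬ (sum (λ i → a (x i)) ≈ ε)

  SumFree : ∀ {m} → ℕ → ℕ → (Fin m → Carrier) → Set ℓ
  SumFree k l a = (x : Fin k → Fin _) (y : Fin l → Fin _) →
    ¬ (sum (λ i → a (x i)) ≈ sum (λ j → a (y j)))

  IsBh : ∀ {m} → ℕ → (Fin m → Carrier) → Set ℓ
  IsBh h a = (x y : Fin h → Fin _) →
    sum (λ i → a (x i)) ≈ sum (λ j → a (y j)) →
    ∃ λ (π : Permutation′ h) → ∀ j → a (y j) ≈ a (x (π ⟨$⟩ʳ j))

{-# OPTIONS --safe #-}
module Submission where

-- A relation λ₁a₁ + ⋯ + λₘaₘ = 0 with Σ|λᵢ| ≤ t is the same thing as an equation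
-- x₁ + ⋯ + x_k = y₁ + ⋯ + y_l between sequences from A with k + l ≤ t: list every aᵢ
-- with λᵢ > 0 exactly λᵢ times among the x's and every aᵢ with λᵢ < 0 exactly −λᵢ times
-- among the y's.  So A is t-independent iff every such equation is trivial, i.e. the
-- two sequences have the same multiplicities.  This gives (i)–(iii) at once.
-- Conversely the sequences coming from a relation have disjoint supports, and for those
-- (i) excludes k = 0 < l and l = 0 < k, (ii) excludes 0 < k ≠ l, distinctness of the aᵢ
-- excludes k = l = 1 and (iii) excludes k = l ≥ 2, since a rearrangement would share a
-- term.  Hence k = l = 0 and all λᵢ vanish.

open import Defs
open import Level using (Level)
open import Algebra.Bundles using (AbelianGroup)
open import Data.Nat using (ℕ; _+_; _≤_; _<_; NonZero; zero; suc; _*_; z≤n; s≤s)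
open import Data.Nat.DivMod using (_/_; m/n*n≤m; m*n/n≡m; /-monoˡ-≤)
open import Data.Fin using (Fin; zero; suc; punchIn; _↑ˡ_; _↑ʳ_; _≟_)
open import Data.Product using (_×_; ∃; Σ; _,_; proj₁; proj₂)
open import Function.Bundles using (_⇔_; mk⇔; Equivalence)

import Algebra.Definitions.RawMonoid as RawMonoidDefinitions
import Algebra.Properties.AbelianGroup as AbelianGroupProperties
import Algebra.Properties.CommutativeMonoid.Sum as CommutativeMonoidSum
import Algebra.Properties.CommutativeSemigroup as CommutativeSemigroupProperties
import Algebra.Properties.Group as GroupProperties
import Algebra.Properties.Monoid.Mult as MonoidMult
import Algebra.Properties.Monoid.Sum as MonoidSum
import Relation.Binary.Reasoning.Setoid as SetoidReasoning
open import Data.Bool using (if_then_else_)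
open import Data.Empty using (⊥; ⊥-elim)
open import Data.Fin.Permutation as Permutation using (Permutation′; _⟨$⟩ʳ_; insert; insert-punchIn)
open import Data.Integer as ℤ using (ℤ; -[1+_]; ∣_∣; _⊖_)
open import Data.Integer.Properties using ([1+m]⊖[1+n]≡m⊖n; ∣m⊝n∣≤m⊔n)
open import Data.Nat.Properties
  using ( ≤-trans; <-irrefl; <-cmp; +-comm; +-assoc; +-identityʳ; *-comm; *-identityʳ; *-zeroʳ
        ; +-mono-≤; *-monoˡ-≤; +-cancelˡ-≡; 1+n≰n; m+n≡0⇒m≡0; m+n≡0⇒n≡0; m⊔n≤m+n
        ; +-commutativeSemigroup; module ≤-Reasoning)
open import Data.Vec.Functional using (replicate; _++_)
open import Data.Vec.Functional.Properties using (lookup-++ˡ; lookup-++ʳ)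
open import Function using (_∘_)
open import Relation.Binary using (tri<; tri≈; tri>)
open import Relation.Binary.PropositionalEquality
  using (_≡_; _≢_; _≗_; refl; sym; trans; cong; cong₂; subst; module ≡-Reasoning)
open import Relation.Nullary using (does; yes; no)

open CommutativeSemigroupProperties +-commutativeSemigroup using (interchange; x∙yz≈y∙xz)

m≤n/o⇒m*o≤n : ∀ {m} n o .{{_ : NonZero o}} → m ≤ n / o → m * o ≤ n
m≤n/o⇒m*o≤n n o m≤n/o = ≤-trans (*-monoˡ-≤ o m≤n/o) (m/n*n≤m n o)

m*o≤n⇒m≤n/o : ∀ m {n} o .{{_ : NonZero o}} → m * o ≤ n → m ≤ n / o
m*o≤n⇒m≤n/o m o m*o≤n = subst (_≤ _ / o) (m*n/n≡m m o) (/-monoˡ-≤ o m*o≤n)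

m*2≡m+m : ∀ m → m * 2 ≡ m + m
m*2≡m+m m = trans (*-comm m 2) (cong (m +_) (+-identityʳ m))

m⊖n≡0⇒m≡n : ∀ {m n} → m ⊖ n ≡ ℤ.+ 0 → m ≡ n
m⊖n≡0⇒m≡n {zero}  {zero}  _ = refl
m⊖n≡0⇒m≡n {suc m} {suc n} e = cong suc (m⊖n≡0⇒m≡n (trans (sym ([1+m]⊖[1+n]≡m⊖n m n)) e))

∣m⊖n∣≤m+n : ∀ m n → ∣ m ⊖ n ∣ ≤ m + n
∣m⊖n∣≤m+n m n = ≤-trans (∣m⊝n∣≤m⊔n m n) (m⊔n≤m+n m n)

posPart negPart : ℤ → ℕ
posPart (ℤ.+ n)   = n
posPart -[1+ n ]  = 0
negPart (ℤ.+ n)   = 0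
negPart -[1+ n ]  = suc n

posPart⊖negPart : ∀ z → posPart z ⊖ negPart z ≡ z
posPart⊖negPart (ℤ.+ n)   = refl
posPart⊖negPart -[1+ n ]  = refl

∣z∣≡posPart+negPart : ∀ z → ∣ z ∣ ≡ posPart z + negPart z
∣z∣≡posPart+negPart (ℤ.+ n)   = sym (+-identityʳ n)
∣z∣≡posPart+negPart -[1+ n ]  = refl

1≤posPart⇒negPart≡0 : ∀ z → 1 ≤ posPart z → negPart z ≡ 0
1≤posPart⇒negPart≡0 (ℤ.+ n) _ = refl

finSumℕ-cong : ∀ {m} {f g : Fin m → ℕ} → f ≗ g → finSumℕ f ≡ finSumℕ g
finSumℕ-cong {zero}  f≗g = refl
finSumℕ-cong {suc m} f≗g = cong₂ _+_ (f≗g zero) (finSumℕ-cong (f≗g ∘ suc))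

finSumℕ-distrib-+ : ∀ {m} (f g : Fin m → ℕ) →
  finSumℕ (λ i → f i + g i) ≡ finSumℕ f + finSumℕ g
finSumℕ-distrib-+ {zero}  f g = refl
finSumℕ-distrib-+ {suc m} f g =
  trans (cong (f zero + g zero +_) (finSumℕ-distrib-+ (f ∘ suc) (g ∘ suc)))
        (interchange (f zero) (g zero) (finSumℕ (f ∘ suc)) (finSumℕ (g ∘ suc)))

finSumℕ-mono-≤ : ∀ {m} {f g : Fin m → ℕ} → (∀ i → f i ≤ g i) → finSumℕ f ≤ finSumℕ g
finSumℕ-mono-≤ {zero}  f≤g = z≤n
finSumℕ-mono-≤ {suc m} f≤g = +-mono-≤ (f≤g zero) (finSumℕ-mono-≤ (f≤g ∘ suc))

finSumℕ-zero : ∀ m → finSumℕ {m} (λ _ → 0) ≡ 0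
finSumℕ-zero zero    = refl
finSumℕ-zero (suc m) = finSumℕ-zero m

finSumℕ≡0⇒≡0 : ∀ {m} (f : Fin m → ℕ) → finSumℕ f ≡ 0 → ∀ i → f i ≡ 0
finSumℕ≡0⇒≡0 f e zero    = m+n≡0⇒m≡0 (f zero) e
finSumℕ≡0⇒≡0 f e (suc i) = finSumℕ≡0⇒≡0 (f ∘ suc) (m+n≡0⇒n≡0 (f zero) e) i

-- Since Fin's _≟_ is structural, δ (suc i) (suc j) reduces to δ i j.
δ : ∀ {m} → Fin m → Fin m → ℕ
δ i j = if does (i ≟ j) then 1 else 0

δ-refl : ∀ {m} (i : Fin m) → δ i i ≡ 1
δ-refl zero    = refl
δ-refl (suc i) = δ-refl i

finSumℕ-δ : ∀ {m} (i : Fin m) → finSumℕ (δ i) ≡ 1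
finSumℕ-δ {suc m} zero    = cong suc (finSumℕ-zero m)
finSumℕ-δ         (suc i) = finSumℕ-δ i

count : ∀ {h m} → (Fin h → Fin m) → Fin m → ℕ
count {zero}  x i = 0
count {suc h} x i = δ (x zero) i + count (x ∘ suc) i

count-cong : ∀ {h m} {x y : Fin h → Fin m} → x ≗ y → count x ≗ count y
count-cong {zero}  x≗y i = refl
count-cong {suc h} x≗y i = cong₂ _+_ (cong (λ k → δ k i) (x≗y zero)) (count-cong (x≗y ∘ suc) i)

finSumℕ-count : ∀ {h m} (x : Fin h → Fin m) → finSumℕ (count x) ≡ h
finSumℕ-count {zero}  {m} x = finSumℕ-zero m
finSumℕ-count {suc h}     x = begin
  finSumℕ (λ i → δ (x zero) i + count (x ∘ suc) i)
    ≡⟨ finSumℕ-distrib-+ (δ (x zero)) (count (x ∘ suc)) ⟩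
  finSumℕ (δ (x zero)) + finSumℕ (count (x ∘ suc))
    ≡⟨ cong₂ _+_ (finSumℕ-δ (x zero)) (finSumℕ-count (x ∘ suc)) ⟩
  suc h ∎
  where open ≡-Reasoning

count-punchIn : ∀ {h m} (x : Fin (suc h) → Fin m) j i →
  count x i ≡ δ (x j) i + count (x ∘ punchIn j) i
count-punchIn         x zero    i = refl
count-punchIn {suc h} x (suc j) i =
  trans (cong (δ (x zero) i +_) (count-punchIn (x ∘ suc) j i))
        (x∙yz≈y∙xz (δ (x zero) i) (δ (x (suc j)) i) _)

1≤count-member : ∀ {h m} (x : Fin h → Fin m) j → 1 ≤ count x (x j)
1≤count-member {suc h} x j rewrite count-punchIn x j (x j) | δ-refl (x j) = s≤s z≤n

1≤count⇒member : ∀ {h m} (x : Fin h → Fin m) i → 1 ≤ count x i → ∃ λ j → x j ≡ i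
1≤count⇒member {suc h} x i 1≤count with x zero ≟ i
... | yes x₀≡i = zero , x₀≡i
... | no  _    with 1≤count⇒member (x ∘ suc) i 1≤count
...   | j , xⱼ≡i = suc j , xⱼ≡i

-- Induction on the length: y zero occurs in x, at j say; delete it from both sides.
count-≗⇒permutation : ∀ {h m} (x y : Fin h → Fin m) → count x ≗ count y →
  Σ (Permutation′ h) λ π → ∀ j → y j ≡ x (π ⟨$⟩ʳ j)
count-≗⇒permutation {zero}  x y _ = Permutation.id , λ ()
count-≗⇒permutation {suc h} x y counts≡
  with 1≤count⇒member x (y zero) (subst (1 ≤_) (sym (counts≡ (y zero))) (1≤count-member y zero))
... | j , xⱼ≡y₀ with count-≗⇒permutation (x ∘ punchIn j) (y ∘ suc) counts≡′
  where
  counts≡′ : count (x ∘ punchIn j) ≗ count (y ∘ suc)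
  counts≡′ i = +-cancelˡ-≡ (δ (y zero) i) _ _ (begin
    δ (y zero) i + count (x ∘ punchIn j) i ≡⟨ cong (λ k → δ k i + _) (sym xⱼ≡y₀) ⟩
    δ (x j) i + count (x ∘ punchIn j) i    ≡⟨ sym (count-punchIn x j i) ⟩
    count x i                              ≡⟨ counts≡ i ⟩
    count y i                              ∎)
    where open ≡-Reasoning
...   | π , y∘suc≡x∘π = insert zero j π , y≡x∘π
  where
  y≡x∘π : ∀ k → y k ≡ x (insert zero j π ⟨$⟩ʳ k)
  y≡x∘π zero    = sym xⱼ≡y₀
  y≡x∘π (suc k) = trans (y∘suc≡x∘π k) (cong x (sym (insert-punchIn zero j π k)))

count-++ : ∀ {a b m} (x : Fin a → Fin m) (y : Fin b → Fin m) (i : Fin m) →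
  count (x ++ y) i ≡ count x i + count y i
count-++ {a} {b} {m} x y i = trans (split a (x ++ y))
  (cong₂ _+_ (count-cong (lookup-++ˡ x y) i) (count-cong (lookup-++ʳ x y) i))
  where
  split : ∀ a (z : Fin (a + b) → Fin m) →
    count z i ≡ count (z ∘ (_↑ˡ b)) i + count (z ∘ (a ↑ʳ_)) i
  split zero    z = refl
  split (suc a) z = trans (cong (δ (z zero) i +_) (split a (z ∘ suc)))
                          (sym (+-assoc (δ (z zero) i) _ _))

count-replicate : ∀ {m} h (k i : Fin m) → count (replicate h k) i ≡ h * δ k i
count-replicate zero    k i = refl
count-replicate (suc h) k i = cong (δ k i +_) (count-replicate h k i)

count-suc-zero : ∀ {h m} (x : Fin h → Fin m) → count (λ j → suc (x j)) zero ≡ 0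
count-suc-zero {zero}  x = refl
count-suc-zero {suc h} x = count-suc-zero (x ∘ suc)

count-suc-suc : ∀ {h m} (x : Fin h → Fin m) i → count (λ j → suc (x j)) (suc i) ≡ count x i
count-suc-suc {zero}  x i = refl
count-suc-suc {suc h} x i = cong (δ (x zero) i +_) (count-suc-suc (x ∘ suc) i)

expand : ∀ {m} (c : Fin m → ℕ) → Fin (finSumℕ c) → Fin m
expand {suc m} c = replicate (c zero) zero ++ (suc ∘ expand (c ∘ suc))

count-expand : ∀ {m} (c : Fin m → ℕ) → count (expand c) ≗ c
count-expand {suc m} c zero = begin
  count (expand c) zero
    ≡⟨ count-++ (replicate (c zero) zero) (suc ∘ expand (c ∘ suc)) zero ⟩
  count (replicate (c zero) zero) zero + count (suc ∘ expand (c ∘ suc)) zero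
    ≡⟨ cong₂ _+_ (count-replicate (c zero) zero zero) (count-suc-zero (expand (c ∘ suc))) ⟩
  c zero * 1 + 0
    ≡⟨ trans (+-identityʳ _) (*-identityʳ (c zero)) ⟩
  c zero ∎
  where open ≡-Reasoning
count-expand {suc m} c (suc i) = begin
  count (expand c) (suc i)
    ≡⟨ count-++ (replicate (c zero) zero) (suc ∘ expand (c ∘ suc)) (suc i) ⟩
  count (replicate (c zero) zero) (suc i) + count (suc ∘ expand (c ∘ suc)) (suc i)
    ≡⟨ cong₂ _+_ (count-replicate (c zero) zero (suc i)) (count-suc-suc (expand (c ∘ suc)) i) ⟩
  c zero * 0 + count (expand (c ∘ suc)) i
    ≡⟨ cong₂ _+_ (*-zeroʳ (c zero)) (count-expand (c ∘ suc) i) ⟩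
  c (suc i) ∎
  where open ≡-Reasoning

expand-positive : ∀ {m} (c : Fin m → ℕ) j → 1 ≤ c (expand c j)
expand-positive c j = subst (1 ≤_) (count-expand c (expand c j)) (1≤count-member (expand c) j)

Disjoint : ∀ {k l m} → (Fin k → Fin m) → (Fin l → Fin m) → Set
Disjoint x y = ∀ i j → x i ≢ y j

expand-posPart-negPart-disjoint : ∀ {m} (λs : Fin m → ℤ) →
  Disjoint (expand (posPart ∘ λs)) (expand (negPart ∘ λs))
expand-posPart-negPart-disjoint λs j j′ pⱼ≡qⱼ′ = 1+n≰n (subst (1 ≤_) negPart≡0 1≤negPart)
  where
  1≤negPart : 1 ≤ negPart (λs (expand (posPart ∘ λs) j))
  1≤negPart = subst (λ i → 1 ≤ negPart (λs i)) (sym pⱼ≡qⱼ′) (expand-positive (negPart ∘ λs) j′)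
  negPart≡0 : negPart (λs (expand (posPart ∘ λs) j)) ≡ 0
  negPart≡0 = 1≤posPart⇒negPart≡0 (λs (expand (posPart ∘ λs) j)) (expand-positive (posPart ∘ λs) j)

module _ {c ℓ} (G : AbelianGroup c ℓ) where
  open AbelianGroup G hiding (refl) renaming (sym to ≈-sym; trans to ≈-trans)
  open RawMonoidDefinitions rawMonoid using (sum) renaming (_×_ to _·ℕ_)
  open MonoidSum monoid using (sum-cong-≋; sum-replicate-zero)
  open MonoidMult monoid using (×-homo-+)
  open CommutativeMonoidSum commutativeMonoid using (∑-distrib-+)
  open GroupProperties group using (x∙y⁻¹≈ε⇒x≈y; x≈y⇒x∙y⁻¹≈ε; ε⁻¹≈ε)
  open AbelianGroupProperties G using (⁻¹-∙-comm)
  open CommutativeSemigroupProperties commutativeSemigroup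
    using () renaming (interchange to ∙-interchange)
  module ≈-Reasoning = SetoidReasoning setoid

  sum-⁻¹ : ∀ {n} (f : Fin n → Carrier) → sum (λ i → f i ⁻¹) ≈ sum f ⁻¹
  sum-⁻¹ {zero}  f = ≈-sym ε⁻¹≈ε
  sum-⁻¹ {suc n} f = ≈-trans (∙-congˡ (sum-⁻¹ (f ∘ suc))) (⁻¹-∙-comm _ _)

  sum-∙⁻¹ : ∀ {n} (f g : Fin n → Carrier) → sum (λ i → f i ∙ g i ⁻¹) ≈ sum f ∙ sum g ⁻¹
  sum-∙⁻¹ f g = ≈-trans (∑-distrib-+ f (λ i → g i ⁻¹)) (∙-congˡ (sum-⁻¹ g))

  sum-δ : ∀ {m} (a : Fin m → Carrier) k → sum (λ i → δ k i ·ℕ a i) ≈ a k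
  sum-δ {suc m} a zero    = ≈-trans (∙-congˡ (sum-replicate-zero m)) (≈-trans (identityʳ _) (identityʳ _))
  sum-δ {suc m} a (suc k) = ≈-trans (identityˡ _) (sum-δ (a ∘ suc) k)

  sum≈sum-count : ∀ {h m} (a : Fin m → Carrier) (x : Fin h → Fin m) →
    sum (a ∘ x) ≈ sum (λ i → count x i ·ℕ a i)
  sum≈sum-count {zero}  {m} a x = ≈-sym (sum-replicate-zero m)
  sum≈sum-count {suc h}     a x = begin
    a (x zero) ∙ sum (a ∘ x ∘ suc)
      ≈⟨ ∙-cong (≈-sym (sum-δ a (x zero))) (sum≈sum-count a (x ∘ suc)) ⟩
    sum (λ i → δ (x zero) i ·ℕ a i) ∙ sum (λ i → count (x ∘ suc) i ·ℕ a i)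
      ≈⟨ ≈-sym (∑-distrib-+ (λ i → δ (x zero) i ·ℕ a i) (λ i → count (x ∘ suc) i ·ℕ a i)) ⟩
    sum (λ i → δ (x zero) i ·ℕ a i ∙ count (x ∘ suc) i ·ℕ a i)
      ≈⟨ sum-cong-≋ (λ i → ≈-sym (×-homo-+ (a i) (δ (x zero) i) _)) ⟩
    sum (λ i → count x i ·ℕ a i) ∎
    where open ≈-Reasoning

  sum∘expand : ∀ {m} (a : Fin m → Carrier) (c : Fin m → ℕ) →
    sum (a ∘ expand c) ≈ sum (λ i → c i ·ℕ a i)
  sum∘expand a c = ≈-trans (sum≈sum-count a (expand c))
    (sum-cong-≋ (λ i → reflexive (cong (_·ℕ a i) (count-expand c i))))

  ⊖-·ℤ : ∀ p q g → _·ℤ_ G (p ⊖ q) g ≈ p ·ℕ g ∙ (q ·ℕ g) ⁻¹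
  ⊖-·ℤ zero    zero    g = ≈-sym (inverseʳ ε)
  ⊖-·ℤ (suc p) zero    g = ≈-sym (≈-trans (∙-congˡ ε⁻¹≈ε) (identityʳ _))
  ⊖-·ℤ zero    (suc q) g = ≈-sym (identityˡ _)
  ⊖-·ℤ (suc p) (suc q) g = begin
    _·ℤ_ G (suc p ⊖ suc q) g    ≡⟨ cong (λ z → _·ℤ_ G z g) ([1+m]⊖[1+n]≡m⊖n p q) ⟩
    _·ℤ_ G (p ⊖ q) g            ≈⟨ ⊖-·ℤ p q g ⟩
    A ∙ B ⁻¹                    ≈⟨ ≈-sym (identityˡ _) ⟩
    ε ∙ (A ∙ B ⁻¹)              ≈⟨ ∙-congʳ (≈-sym (inverseʳ g)) ⟩
    (g ∙ g ⁻¹) ∙ (A ∙ B ⁻¹)     ≈⟨ ∙-interchange g (g ⁻¹) A (B ⁻¹) ⟩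
    (g ∙ A) ∙ (g ⁻¹ ∙ B ⁻¹)     ≈⟨ ∙-congˡ (⁻¹-∙-comm g B) ⟩
    (g ∙ A) ∙ (g ∙ B) ⁻¹        ∎
    where
    open ≈-Reasoning
    A = p ·ℕ g
    B = q ·ℕ g

  ∑⊖·ℤ≈ε⇔∑≈∑ : ∀ {m} (p q : Fin m → ℕ) (a : Fin m → Carrier) →
    sum (λ i → _·ℤ_ G (p i ⊖ q i) (a i)) ≈ ε ⇔
    sum (λ i → p i ·ℕ a i) ≈ sum (λ i → q i ·ℕ a i)
  ∑⊖·ℤ≈ε⇔∑≈∑ p q a = mk⇔
    (λ e → x∙y⁻¹≈ε⇒x≈y _ _ (≈-trans (≈-sym difference) e))
    (λ e → ≈-trans difference (x≈y⇒x∙y⁻¹≈ε e))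
    where
    difference : sum (λ i → _·ℤ_ G (p i ⊖ q i) (a i)) ≈
                 sum (λ i → p i ·ℕ a i) ∙ sum (λ i → q i ·ℕ a i) ⁻¹
    difference = ≈-trans (sum-cong-≋ (λ i → ⊖-·ℤ (p i) (q i) (a i))) (sum-∙⁻¹ (λ i → p i ·ℕ a i) (λ i → q i ·ℕ a i))

  SumConditions : ∀ {m} → ℕ → (Fin m → Carrier) → Set ℓ
  SumConditions t a =
      ((h : ℕ) → 1 ≤ h → h ≤ t → ZeroSumFree G h a)
    × ((k l : ℕ) → 1 ≤ l → l < k → k + l ≤ t → SumFree G k l a)
    × ((h : ℕ) → 2 ≤ h → h ≤ t / 2 → IsBh G h a)

  module _ {m} (a : Fin m → Carrier) (t : ℕ) where

    independent⇒count-≗ : Independent G t a →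
      ∀ {k l} (x : Fin k → Fin m) (y : Fin l → Fin m) →
      k + l ≤ t → sum (a ∘ x) ≈ sum (a ∘ y) → count x ≗ count y
    independent⇒count-≗ independent {k} {l} x y k+l≤t Σx≈Σy i =
      m⊖n≡0⇒m≡n (independent (λ j → count x j ⊖ count y j) bounded relation i)
      where
      bounded : finSumℕ (λ j → ∣ count x j ⊖ count y j ∣) ≤ t
      bounded = begin
        finSumℕ (λ j → ∣ count x j ⊖ count y j ∣)
          ≤⟨ finSumℕ-mono-≤ (λ j → ∣m⊖n∣≤m+n (count x j) (count y j)) ⟩
        finSumℕ (λ j → count x j + count y j)
          ≡⟨ finSumℕ-distrib-+ (count x) (count y) ⟩
        finSumℕ (count x) + finSumℕ (count y)
          ≡⟨ cong₂ _+_ (finSumℕ-count x) (finSumℕ-count y) ⟩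
        k + l
          ≤⟨ k+l≤t ⟩
        t ∎
        where open ≤-Reasoning
      relation : sum (λ j → _·ℤ_ G (count x j ⊖ count y j) (a j)) ≈ ε
      relation = Equivalence.from (∑⊖·ℤ≈ε⇔∑≈∑ (count x) (count y) a)
        (≈-trans (≈-sym (sum≈sum-count a x)) (≈-trans Σx≈Σy (sum≈sum-count a y)))

    independent⇒length-≡ : Independent G t a →
      ∀ {k l} (x : Fin k → Fin m) (y : Fin l → Fin m) →
      k + l ≤ t → sum (a ∘ x) ≈ sum (a ∘ y) → k ≡ l
    independent⇒length-≡ independent x y k+l≤t Σx≈Σy =
      trans (sym (finSumℕ-count x))
        (trans (finSumℕ-cong (independent⇒count-≗ independent x y k+l≤t Σx≈Σy)) (finSumℕ-count y))

    independent⇒sumConditions : Independent G t a → SumConditions t a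
    independent⇒sumConditions independent = zeroSumFree , sumFree , isBh
      where
      zeroSumFree : (h : ℕ) → 1 ≤ h → h ≤ t → ZeroSumFree G h a
      zeroSumFree (suc h) _ h≤t x Σx≈ε
        with () ← independent⇒length-≡ independent x (λ ()) (subst (_≤ t) (sym (+-identityʳ _)) h≤t) Σx≈ε
      sumFree : (k l : ℕ) → 1 ≤ l → l < k → k + l ≤ t → SumFree G k l a
      sumFree k l _ l<k k+l≤t x y Σx≈Σy =
        <-irrefl (sym (independent⇒length-≡ independent x y k+l≤t Σx≈Σy)) l<k
      isBh : (h : ℕ) → 2 ≤ h → h ≤ t / 2 → IsBh G h a
      isBh h _ h≤t/2 x y Σx≈Σy
        with π , y≡x∘π ← count-≗⇒permutation x y (independent⇒count-≗ independent x y
               (subst (_≤ t) (m*2≡m+m h) (m≤n/o⇒m*o≤n t 2 h≤t/2)) Σx≈Σy)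
        = π , λ j → reflexive (cong a (y≡x∘π j))

    equal-length-disjoint-sums⇒⊥ : Distinct G a → ((h : ℕ) → 2 ≤ h → h ≤ t / 2 → IsBh G h a) →
      ∀ h (x y : Fin (suc h) → Fin m) → Disjoint x y →
      suc h + suc h ≤ t → sum (a ∘ x) ≈ sum (a ∘ y) → ⊥
    equal-length-disjoint-sums⇒⊥ distinct _ zero x y disjoint _ Σx≈Σy =
      disjoint zero zero (distinct _ _ (≈-trans (≈-sym (identityʳ _)) (≈-trans Σx≈Σy (identityʳ _))))
    equal-length-disjoint-sums⇒⊥ distinct isBh (suc h) x y disjoint 2h≤t Σx≈Σy
      with π , y≈x∘π ← isBh (suc (suc h)) (s≤s (s≤s z≤n))
             (m*o≤n⇒m≤n/o (suc (suc h)) 2 (subst (_≤ t) (sym (m*2≡m+m _)) 2h≤t)) x y Σx≈Σy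
      = disjoint (π ⟨$⟩ʳ zero) zero (sym (distinct _ _ (y≈x∘π zero)))

    disjoint-sums⇒empty : Distinct G a → SumConditions t a →
      ∀ k l (x : Fin k → Fin m) (y : Fin l → Fin m) → Disjoint x y →
      k + l ≤ t → sum (a ∘ x) ≈ sum (a ∘ y) → k ≡ 0 × l ≡ 0
    disjoint-sums⇒empty _ _ zero zero x y _ _ _ = refl , refl
    disjoint-sums⇒empty _ (zeroSumFree , _ , _) zero (suc l) x y _ l≤t Σx≈Σy =
      ⊥-elim (zeroSumFree (suc l) (s≤s z≤n) l≤t y (≈-sym Σx≈Σy))
    disjoint-sums⇒empty _ (zeroSumFree , _ , _) (suc k) zero x y _ k+0≤t Σx≈Σy =
      ⊥-elim (zeroSumFree (suc k) (s≤s z≤n) (subst (_≤ t) (+-identityʳ _) k+0≤t) x Σx≈Σy)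
    disjoint-sums⇒empty distinct (_ , sumFree , isBh) (suc k) (suc l) x y disjoint k+l≤t Σx≈Σy
      with <-cmp (suc k) (suc l)
    ... | tri< k<l _ _ = ⊥-elim (sumFree (suc l) (suc k) (s≤s z≤n) k<l
                           (subst (_≤ t) (+-comm (suc k) (suc l)) k+l≤t) y x (≈-sym Σx≈Σy))
    ... | tri≈ _ refl _ = ⊥-elim (equal-length-disjoint-sums⇒⊥ distinct isBh k x y disjoint k+l≤t Σx≈Σy)
    ... | tri> _ _ l<k = ⊥-elim (sumFree (suc k) (suc l) (s≤s z≤n) l<k k+l≤t x y Σx≈Σy)

    sumConditions⇒independent : Distinct G a → SumConditions t a → Independent G t a
    sumConditions⇒independent distinct conditions λs bounded relation i = begin
      λs i       ≡⟨ sym (posPart⊖negPart (λs i)) ⟩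
      p i ⊖ q i  ≡⟨ cong₂ _⊖_ (finSumℕ≡0⇒≡0 p (proj₁ Σp≡0×Σq≡0) i) (finSumℕ≡0⇒≡0 q (proj₂ Σp≡0×Σq≡0) i) ⟩
      ℤ.+ 0      ∎
      where
      open ≡-Reasoning
      p q : Fin m → ℕ
      p = posPart ∘ λs
      q = negPart ∘ λs
      Σp+Σq≤t : finSumℕ p + finSumℕ q ≤ t
      Σp+Σq≤t = subst (_≤ t)
        (trans (finSumℕ-cong (∣z∣≡posPart+negPart ∘ λs)) (finSumℕ-distrib-+ p q)) bounded
      Σp≈Σq : sum (a ∘ expand p) ≈ sum (a ∘ expand q)
      Σp≈Σq = ≈-trans (sum∘expand a p) (≈-trans (Equivalence.to (∑⊖·ℤ≈ε⇔∑≈∑ p q a)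
        (≈-trans (sum-cong-≋ (λ j → reflexive (cong (λ z → _·ℤ_ G z (a j)) (posPart⊖negPart (λs j)))))
                 relation))
        (≈-sym (sum∘expand a q)))
      Σp≡0×Σq≡0 : finSumℕ p ≡ 0 × finSumℕ q ≡ 0
      Σp≡0×Σq≡0 = disjoint-sums⇒empty distinct conditions _ _ (expand p) (expand q)
        (expand-posPart-negPart-disjoint λs) Σp+Σq≤t Σp≈Σq

mainTheorem1 : ∀ {c ℓ : Level} (G : AbelianGroup c ℓ) → IsFiniteGroup G →
    ∀ {m} (a : Fin m → AbelianGroup.Carrier G) → Distinct G a → (t : ℕ) →
    Independent G t a ⇔
      (((h : ℕ) → 1 ≤ h → h ≤ t → ZeroSumFree G h a)
      × ((k l : ℕ) → 1 ≤ l → l < k → k + l ≤ t → SumFree G k l a)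
      × ((h : ℕ) → 2 ≤ h → h ≤ t / 2 → IsBh G h a))
mainTheorem1 G _ a distinct t =
  mk⇔ (independent⇒sumConditions G a t) (sumConditions⇒independent G a t distinct)
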